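{- Let $q=p^f$, $d\ge1$, $N\in\mathbb{Z}_+$, and let $B$ be a valid matrix of $W_d(N)$. Then the $\tau$-monotonic composition in $W_d^B(N)$ is lexicographically the largest element of $W_d^B(N)$ and achieves the unique minimum weight in $W_d^B(N)$. In particular, both the modest composition and every optimal composition of $W_d(N)$ are $\tau$-monotonic.
   Context: $p$ is prime, $q=p^f$, an integer is $q$-even if divisible by $q-1$. For $d>0$, $N\in\mathbb{N}$, $W_d(N)$ is the set of $(X_1,\ldots,X_d)\in\mathbb{N}^d$ with $N=\sum_iX_i$ with no carry-over of digits in base $p$, and $X_i>0$ $q$-even for $1\le i<d$. Modest = lexicographically largest element of $W_d(N)$; weight $\mathrm{wt}(\mathbf{X})=\sum_i iX_i$; optimal = of minimum weight in $W_d(N)$. For $n\ge0$ with base-$p$ expansion $n=\sum_j a_jp^j$, $\Gamma(n)\in\mathbb{N}^f$ is the column vector $[\mu_0,\ldots,\mu_{f-1}]^t$ with $\mu_i=\sum_{j\equiv i \bmod f}a_j$; for a composition $\mathbf{X}$, $\Gamma(\mathbf{X})$ is the $f\times d$ matrix with columns $\Gamma(X_1),\ldots,\Gamma(X_d)$. For $B\in\mathrm{Mat}_{f\times d}(\mathbb{N})$, $W_d^B(N)=\{\mathbf{X}\in W_d(N):\Gamma(\mathbf{X})=B\}$, and $B$ is valid if $W_d^B(N)\ne\emptyset$. For $n>0$ and $0\le k<f$, $\tau_k(n)$ is the nonincreasing sequence of the $p$-powers $p^j$, $j\equiv k\bmod f$, each repeated $a_j$ times. $\mathbf{X}\in W_d(N)$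 is $\tau$-monotonic if for each $0\le k<f$ the sequence $\tau_k(N)$ is the concatenation of $\tau_k(X_1),\tau_k(X_2),\ldots,\tau_k(X_d)$ (with $\tau_k(0)$ empty). For each valid $B$ there is a unique $\tau$-monotonic composition in $W_d^B(N)$. -}

module Defs where

open import Data.Nat using (ℕ; zero; suc; _+_; _*_; _∸_; _^_; _≤_; _<_; _%_; _/_)
open import Data.Nat.Divisibility using (_∣_)
open import Data.Nat.Properties using (_≟_)
open import Data.Fin using (Fin; toℕ)
open import Data.Vec using (Vec; []; _∷_; lookup; toList)
open import Data.List using (List; []; _∷_; _++_; replicate; concat; map; reverse; upTo)
open import Data.Nat.ListAction using (sum)
open import Data.Product using (_×_; Σ; ∃)
open import Relation.Binary.PropositionalEquality using (_≡_)
open import Relation.Nullary.Decidable using (⌊_⌋)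
open import Data.Bool using (if_then_else_)

-- j-th base-p digit of n (least significant digit is j = 0).
-- The case p = 0 is irrelevant (p is always prime below); it is set to 0.
digit : (p j n : ℕ) → ℕ
digit zero    j       n = 0
digit (suc p) zero    n = n % suc p
digit (suc p) (suc j) n = digit (suc p) j (n / suc p)

-- Γ component: μ_k(n) = Σ_{j ≡ k mod f} a_j.
-- Digits a_j vanish for j ≥ n (since p ≥ 2, p^n > n), so summing over j < n+1 is exact.
-- The case f = 0 is irrelevant (f ≥ 1 below).
mu : (p f k n : ℕ) → ℕ
mu p zero    k n = 0
mu p (suc f) k n =
  sum (map (λ j → if ⌊ j % suc f ≟ k ⌋ then digit p j n else 0) (upTo (suc n)))

Gamma : (p f : ℕ) → ℕ → Fin f → ℕ
Gamma p f n k = mu p f (toℕ k) n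

-- τ_k(n): nonincreasing list of the powers p^j, j ≡ k mod f, each repeated a_j times
-- (j runs over 0 … n in decreasing order; digits beyond vanish).  τ_k(0) = [].
tau : (p f k n : ℕ) → List ℕ
tau p zero    k n = []
tau p (suc f) k n =
  concat (map (λ j → if ⌊ j % suc f ≟ k ⌋ then replicate (digit p j n) (p ^ j) else [])
              (reverse (upTo (suc n))))

InW : (p f d N : ℕ) → Vec ℕ d → Set
InW p f d N X =
  (sum (toList X) ≡ N)
  × (∀ (j : ℕ) → sum (map (digit p j) (toList X)) < p)          -- no carry-over in base p
  × (∀ (i : Fin d) → suc (toℕ i) < d →                           -- X_i, 1 ≤ i < d (1-based)
        (0 < lookup X i) × ((p ^ f ∸ 1) ∣ lookup X i))          -- positive and q-even

InWB : (p f d N : ℕ) → (Fin f → Fin d → ℕ) → Vec ℕ d → Set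
InWB p f d N B X = InW p f d N X × (∀ (k : Fin f) (i : Fin d) → Gamma p f (lookup X i) k ≡ B k i)

Valid : (p f d N : ℕ) → (Fin f → Fin d → ℕ) → Set
Valid p f d N B = Σ (Vec ℕ d) (InWB p f d N B)

data _≤lex_ : {n : ℕ} → Vec ℕ n → Vec ℕ n → Set where
  lex-[] : [] ≤lex []
  lex-<  : ∀ {n x y} {xs ys : Vec ℕ n} → x < y → (x ∷ xs) ≤lex (y ∷ ys)
  lex-≡  : ∀ {n x} {xs ys : Vec ℕ n} → xs ≤lex ys → (x ∷ xs) ≤lex (x ∷ ys)

wtFrom : {n : ℕ} → ℕ → Vec ℕ n → ℕ
wtFrom k []       = 0
wtFrom k (x ∷ xs) = k * x + wtFrom (suc k) xs

wt : {n : ℕ} → Vec ℕ n → ℕ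
wt = wtFrom 1

TauMonotonic : (p f d N : ℕ) → Vec ℕ d → Set
TauMonotonic p f d N X =
  ∀ (k : Fin f) → tau p f (toℕ k) N ≡ concat (map (tau p f (toℕ k)) (toList X))

Modest : (p f d N : ℕ) → Vec ℕ d → Set
Modest p f d N X = InW p f d N X × (∀ Y → InW p f d N Y → Y ≤lex X)

Optimal : (p f d N : ℕ) → Vec ℕ d → Set
Optimal p f d N X = InW p f d N X × (∀ Y → InW p f d N Y → wt X ≤ wt Y)

-- The argument is an exchange argument.  Call a pair of entries X_i, X_{i'} (i < i') an
-- inversion if X_i has a nonzero digit at a position j and X_{i'} one at a position
-- j' > j with j ≡ j' (mod f).  Then:
--  * an inversion-free X ∈ W_d(N) is τ-monotonic, since the concatenation of the
--    τ_k(X_i) is then descending and has the same multiplicities as τ_k(N);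
--  * a τ-monotonic composition is determined by Γ (the lengths μ_k cut τ_k(N) into the
--    τ_k(X_i), and τ determines digits);
--  * trading p^j in X_i for p^{j'} in X_{i'} moves D = p^j (q^e - 1) > 0 from X_{i'} to
--    X_i, staying in W_d^B(N) while increasing lexicographically and decreasing weight.
-- Induction on the weight then gives the theorem.

module Submission where

open import Defs
open import Data.Nat.Primality using (Prime; prime⇒nonTrivial)
open import Data.Nat using (ℕ; zero; suc; _+_; _*_; _∸_; _^_; _%_; _/_; _≤_; _<_; z≤n; s≤s; _≟_; _<?_; nonTrivial⇒n>1; >-nonZero)
open import Function using (_∘_)
open import Data.Nat.Properties
open import Data.Nat.DivMod
open import Data.Nat.Divisibility using (_∣_; ∣m+n∣m⇒∣n; ∣n⇒∣m*n; n∣m*n; ∣m∣n⇒∣m+n)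
open import Data.Nat.ListAction using (sum)
open import Data.Nat.ListAction.Properties using (sum-++)
open import Data.Nat.Induction using (<-rec)
open import Algebra.Properties.CommutativeSemigroup +-commutativeSemigroup using (interchange; xy∙z≈zy∙x; xy∙z≈xz∙y; x∙yz≈xz∙y)
open import Data.Bool using (Bool; true; false; if_then_else_)
open import Data.Fin using (Fin; toℕ; fromℕ<) renaming (zero to fzero; suc to fsuc)
open import Data.Fin.Properties using (toℕ-fromℕ<; toℕ<n) renaming (_≟_ to _≟ᶠ_)
open import Data.Vec using (Vec; lookup; toList; _[_]≔_) renaming ([] to []ᵛ; _∷_ to _∷ᵛ_)
open import Data.Vec.Properties using (tabulate∘lookup; tabulate-cong; lookup∘update; lookup∘update′; ≡-dec)
open import Data.List using (List; []; _∷_; _++_; map; concat; replicate; upTo; downFrom; length)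
open import Data.List.Properties using (map-++; upTo-∷ʳ; reverse-upTo; length-++; length-replicate; map-∘; map-id; ∷-injectiveʳ; ∷-injectiveˡ)
open import Data.List.Membership.Propositional using (_∈_)
open import Data.List.Membership.Propositional.Properties using (∈-++⁻)
open import Data.List.Relation.Unary.Any using (here; there)
open import Data.List.Relation.Unary.All as All using (All; []; _∷_)
open import Data.List.Relation.Unary.AllPairs using (AllPairs; []; _∷_)
import Data.List.Relation.Unary.AllPairs.Properties as AllPairs
import Data.List.Relation.Unary.All.Properties as All
open import Data.Product using (Σ; ∃; _×_; _,_; proj₁; proj₂)
open import Data.Sum using (inj₁; inj₂)
open import Data.Empty using (⊥-elim)
open import Relation.Nullary using (¬_; Dec; yes; no)
open import Relation.Nullary.Decidable using (⌊_⌋; decidable-stable; ¬¬-excluded-middle)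
open import Relation.Nullary.Negation using (¬¬-map)
open import Relation.Binary.Definitions using (tri<; tri≈; tri>)
open import Relation.Binary.PropositionalEquality
  using (_≡_; _≢_; refl; sym; trans; cong; cong₂; subst; subst₂; module ≡-Reasoning)

-- Sums over an initial segment of ℕ: ∑< M g = g 0 + … + g (M - 1).
-- μ and τ are defined by ranging over the digit positions j ≤ n;
-- these sums let us enlarge such ranges and exchange them with list sums.
∑< : ℕ → (ℕ → ℕ) → ℕ
∑< zero    g = 0
∑< (suc M) g = ∑< M g + g M

sum-upTo : ∀ M g → sum (map g (upTo M)) ≡ ∑< M g
sum-upTo zero    g = refl
sum-upTo (suc M) g = begin
  sum (map g (upTo (suc M)))          ≡⟨ cong (λ l → sum (map g l)) (upTo-∷ʳ M) ⟨
  sum (map g (upTo M ++ M ∷ []))      ≡⟨ cong sum (map-++ g (upTo M) (M ∷ [])) ⟩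
  sum (map g (upTo M) ++ g M ∷ [])    ≡⟨ sum-++ (map g (upTo M)) (g M ∷ []) ⟩
  sum (map g (upTo M)) + (g M + 0)    ≡⟨ cong₂ _+_ (sum-upTo M g) (+-identityʳ (g M)) ⟩
  ∑< M g + g M                        ∎
  where open ≡-Reasoning

∑<-cong : ∀ M {g h} → (∀ j → g j ≡ h j) → ∑< M g ≡ ∑< M h
∑<-cong zero    e = refl
∑<-cong (suc M) e = cong₂ _+_ (∑<-cong M e) (e M)

∑<-+ : ∀ M g h → ∑< M (λ j → g j + h j) ≡ ∑< M g + ∑< M h
∑<-+ zero    g h = refl
∑<-+ (suc M) g h = trans (cong (_+ (g M + h M)) (∑<-+ M g h))
                         (interchange (∑< M g) (∑< M h) (g M) (h M))

∑<-vanish : ∀ M g → (∀ j → j < M → g j ≡ 0) → ∑< M g ≡ 0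
∑<-vanish zero    g z = refl
∑<-vanish (suc M) g z = cong₂ _+_ (∑<-vanish M g (λ j j<M → z j (m<n⇒m<1+n j<M))) (z M ≤-refl)

∑<-extend : ∀ M M' g → M ≤ M' → (∀ j → M ≤ j → g j ≡ 0) → ∑< M' g ≡ ∑< M g
∑<-extend M M' g M≤M' z = trans (cong (λ K → ∑< K g) (sym (m∸n+n≡m M≤M'))) (pad (M' ∸ M))
  where
  pad : ∀ e → ∑< (e + M) g ≡ ∑< M g
  pad zero    = refl
  pad (suc e) = trans (cong (∑< (e + M) g +_) (z (e + M) (m≤n+m M e)))
                      (trans (+-identityʳ _) (pad e))

∑<-single : ∀ M g j₀ → (∀ j → j ≢ j₀ → g j ≡ 0) → (M ≤ j₀ → g j₀ ≡ 0) → ∑< M g ≡ g j₀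
∑<-single zero    g j₀ z z' = sym (z' z≤n)
∑<-single (suc M) g j₀ z z' with M ≟ j₀
... | yes refl = cong (_+ g M) (∑<-vanish M g (λ j j<M → z j (<⇒≢ j<M)))
... | no M≢j₀  = trans (cong₂ _+_ (∑<-single M g j₀ z (λ M≤j₀ → z' (≤∧≢⇒< M≤j₀ M≢j₀))) (z M M≢j₀))
                       (+-identityʳ _)

sum-∑< : ∀ {A : Set} M (g : A → ℕ → ℕ) xs →
         sum (map (λ x → ∑< M (g x)) xs) ≡ ∑< M (λ j → sum (map (λ x → g x j) xs))
sum-∑< M g []       = sym (∑<-vanish M (λ _ → 0) (λ _ _ → refl))
sum-∑< M g (x ∷ xs) = trans (cong (∑< M (g x) +_) (sum-∑< M g xs)) (sym (∑<-+ M (g x) _))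

if-+ : ∀ (b : Bool) u w → (if b then u + w else 0) ≡ (if b then u else 0) + (if b then w else 0)
if-+ true  u w = refl
if-+ false u w = refl

if-0 : ∀ (b : Bool) {u} → u ≡ 0 → (if b then u else 0) ≡ 0
if-0 true  u≡0 = u≡0
if-0 false u≡0 = refl

sum-if : ∀ {A : Set} (b : Bool) (h : A → ℕ) xs →
         sum (map (λ x → if b then h x else 0) xs) ≡ (if b then sum (map h xs) else 0)
sum-if true  h xs       = refl
sum-if false h []       = refl
sum-if false h (x ∷ xs) = sum-if false h xs

occ : ℕ → List ℕ → ℕ
occ v []       = 0
occ v (x ∷ xs) = (if ⌊ v ≟ x ⌋ then 1 else 0) + occ v xs

occ-++ : ∀ v xs ys → occ v (xs ++ ys) ≡ occ v xs + occ v ys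
occ-++ v []       ys = refl
occ-++ v (x ∷ xs) ys = trans (cong (_ +_) (occ-++ v xs ys)) (sym (+-assoc _ (occ v xs) (occ v ys)))

occ-replicate : ∀ v c w → occ v (replicate c w) ≡ (if ⌊ v ≟ w ⌋ then c else 0)
occ-replicate v zero w with v ≟ w
... | yes _ = refl
... | no  _ = refl
occ-replicate v (suc c) w with v ≟ w | occ-replicate v c w
... | yes _ | e = cong suc e
... | no  _ | e = e

occ-concat : ∀ v xss → occ v (concat xss) ≡ sum (map (occ v) xss)
occ-concat v []         = refl
occ-concat v (xs ∷ xss) = trans (occ-++ v xs (concat xss)) (cong (occ v xs +_) (occ-concat v xss))

occ-head : ∀ v xs → 0 < occ v (v ∷ xs)
occ-head v xs with v ≟ v
... | yes _   = s≤s z≤n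
... | no  v≢v = ⊥-elim (v≢v refl)

occ-absent : ∀ v xs → All (_< v) xs → occ v xs ≡ 0
occ-absent v []       []             = refl
occ-absent v (x ∷ xs) (x<v ∷ xs<v) with v ≟ x
... | yes refl = ⊥-elim (<-irrefl refl x<v)
... | no  _    = occ-absent v xs xs<v

Descending : List ℕ → Set
Descending = AllPairs (λ x y → y ≤ x)

descending-unique : ∀ xs ys → Descending xs → Descending ys → (∀ v → occ v xs ≡ occ v ys) → xs ≡ ys
descending-unique []       []       _ _ _ = refl
descending-unique []       (y ∷ ys) _ _ o = ⊥-elim (<-irrefl (o y) (occ-head y ys))
descending-unique (x ∷ xs) []       _ _ o = ⊥-elim (<-irrefl (sym (o x)) (occ-head x xs))
descending-unique (x ∷ xs) (y ∷ ys) (x≥xs ∷ dxs) (y≥ys ∷ dys) o with <-cmp x y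
... | tri< x<y _ _ = ⊥-elim (<-irrefl (trans (sym (occ-absent y (x ∷ xs) (x<y ∷ All.map (λ z≤x → ≤-<-trans z≤x x<y) x≥xs))) (o y)) (occ-head y ys))
... | tri> _ _ y<x = ⊥-elim (<-irrefl (trans (sym (occ-absent x (y ∷ ys) (y<x ∷ All.map (λ z≤y → ≤-<-trans z≤y y<x) y≥ys))) (sym (o x))) (occ-head x xs))
... | tri≈ _ refl _ = cong (x ∷_) (descending-unique xs ys dxs dys (λ v → +-cancelˡ-≡ _ _ _ (o v)))

replicate-∈ : ∀ {c w u : ℕ} → u ∈ replicate c w → u ≡ w
replicate-∈ {suc c} (here u≡w) = u≡w
replicate-∈ {suc c} (there u∈) = replicate-∈ {c} u∈

replicate-descending : ∀ c w → Descending (replicate c w)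
replicate-descending zero    w = []
replicate-descending (suc c) w = All.tabulate (λ u∈ → ≤-reflexive (replicate-∈ {c} u∈)) ∷ replicate-descending c w

vec-ext : ∀ {d} (X Y : Vec ℕ d) → (∀ i → lookup X i ≡ lookup Y i) → X ≡ Y
vec-ext X Y e = trans (sym (tabulate∘lookup X)) (trans (tabulate-cong e) (tabulate∘lookup Y))

all-entries : ∀ {d} (Q : ℕ → Set) (X : Vec ℕ d) → (∀ i → Q (lookup X i)) → All Q (toList X)
all-entries Q []ᵛ       q = []
all-entries Q (x ∷ᵛ X) q = q fzero ∷ all-entries Q X (λ i → q (fsuc i))

allPairs-entries : ∀ {d} (R : ℕ → ℕ → Set) (X : Vec ℕ d) →
  (∀ i i' → toℕ i < toℕ i' → R (lookup X i) (lookup X i')) → AllPairs R (toList X)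
allPairs-entries R []ᵛ       r = []
allPairs-entries R (x ∷ᵛ X) r = all-entries (R x) X (λ i → r fzero (fsuc i) (s≤s z≤n))
                              ∷ allPairs-entries R X (λ i i' i<i' → r (fsuc i) (fsuc i') (s≤s i<i'))

++-split : ∀ (as bs cs ds : List ℕ) → length as ≡ length bs → as ++ cs ≡ bs ++ ds → as ≡ bs × cs ≡ ds
++-split []       []       cs ds _ e = refl , e
++-split (a ∷ as) (b ∷ bs) cs ds l e with ++-split as bs cs ds (suc-injective l) (∷-injectiveʳ e)
... | as≡bs , cs≡ds = cong₂ _∷_ (∷-injectiveˡ e) as≡bs , cs≡ds

concat-split : ∀ {d} (X Y : Vec ℕ d) (G : ℕ → List ℕ) →
  (∀ i → length (G (lookup X i)) ≡ length (G (lookup Y i))) →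
  concat (map G (toList X)) ≡ concat (map G (toList Y)) → ∀ i → G (lookup X i) ≡ G (lookup Y i)
concat-split (x ∷ᵛ X) (y ∷ᵛ Y) G l e fzero    = proj₁ (++-split (G x) (G y) _ _ (l fzero) e)
concat-split (x ∷ᵛ X) (y ∷ᵛ Y) G l e (fsuc i) =
  concat-split X Y G (λ i → l (fsuc i)) (proj₂ (++-split (G x) (G y) _ _ (l fzero) e)) i

∑ᵛ : ∀ {d} → (ℕ → ℕ) → Vec ℕ d → ℕ
∑ᵛ G X = sum (map G (toList X))

entry≤∑ᵛ : ∀ {d} G (X : Vec ℕ d) i → G (lookup X i) ≤ ∑ᵛ G X
entry≤∑ᵛ G (x ∷ᵛ X) fzero    = m≤m+n (G x) _
entry≤∑ᵛ G (x ∷ᵛ X) (fsuc i) = ≤-trans (entry≤∑ᵛ G X i) (m≤n+m _ (G x))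

two-entries≤∑ᵛ : ∀ {d} G (X : Vec ℕ d) i i' → i ≢ i' → G (lookup X i) + G (lookup X i') ≤ ∑ᵛ G X
two-entries≤∑ᵛ G (x ∷ᵛ X) fzero    fzero     i≢i' = ⊥-elim (i≢i' refl)
two-entries≤∑ᵛ G (x ∷ᵛ X) fzero    (fsuc i') _    = +-monoʳ-≤ (G x) (entry≤∑ᵛ G X i')
two-entries≤∑ᵛ G (x ∷ᵛ X) (fsuc i) fzero     _    =
  subst (_≤ G x + ∑ᵛ G X) (+-comm (G x) _) (+-monoʳ-≤ (G x) (entry≤∑ᵛ G X i))
two-entries≤∑ᵛ G (x ∷ᵛ X) (fsuc i) (fsuc i') i≢i' =
  ≤-trans (two-entries≤∑ᵛ G X i i' (λ e → i≢i' (cong fsuc e))) (m≤n+m _ (G x))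

∑ᵛ-update : ∀ {d} G (X : Vec ℕ d) i a → ∑ᵛ G (X [ i ]≔ a) + G (lookup X i) ≡ ∑ᵛ G X + G a
∑ᵛ-update G (x ∷ᵛ X) fzero    a = xy∙z≈zy∙x (G a) (∑ᵛ G X) (G x)
∑ᵛ-update G (x ∷ᵛ X) (fsuc i) a = trans (+-assoc (G x) _ _)
  (trans (cong (G x +_) (∑ᵛ-update G X i a)) (sym (+-assoc (G x) _ _)))

wtFrom-update : ∀ {d} k (X : Vec ℕ d) i a →
  wtFrom k (X [ i ]≔ a) + (k + toℕ i) * lookup X i ≡ wtFrom k X + (k + toℕ i) * a
wtFrom-update k (x ∷ᵛ X) fzero a rewrite +-identityʳ k = xy∙z≈zy∙x (k * a) (wtFrom (suc k) X) (k * x)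
wtFrom-update k (x ∷ᵛ X) (fsuc i) a = begin
  k * x + wtFrom (suc k) (X [ i ]≔ a) + (k + suc (toℕ i)) * lookup X i
    ≡⟨ cong (λ c → k * x + wtFrom (suc k) (X [ i ]≔ a) + c * lookup X i) (+-suc k (toℕ i)) ⟩
  k * x + wtFrom (suc k) (X [ i ]≔ a) + (suc k + toℕ i) * lookup X i
    ≡⟨ +-assoc (k * x) _ _ ⟩
  k * x + (wtFrom (suc k) (X [ i ]≔ a) + (suc k + toℕ i) * lookup X i)
    ≡⟨ cong (k * x +_) (wtFrom-update (suc k) X i a) ⟩
  k * x + (wtFrom (suc k) X + (suc k + toℕ i) * a)
    ≡⟨ +-assoc (k * x) _ _ ⟨
  k * x + wtFrom (suc k) X + (suc k + toℕ i) * a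
    ≡⟨ cong (λ c → k * x + wtFrom (suc k) X + c * a) (+-suc k (toℕ i)) ⟨
  k * x + wtFrom (suc k) X + (k + suc (toℕ i)) * a
    ∎
  where open ≡-Reasoning

lex-refl : ∀ {d} (X : Vec ℕ d) → X ≤lex X
lex-refl []ᵛ       = lex-[]
lex-refl (x ∷ᵛ X) = lex-≡ (lex-refl X)

lex-trans : ∀ {d} {X Y Z : Vec ℕ d} → X ≤lex Y → Y ≤lex Z → X ≤lex Z
lex-trans lex-[]      lex-[]      = lex-[]
lex-trans (lex-< x<y) (lex-< y<z) = lex-< (<-trans x<y y<z)
lex-trans (lex-< x<y) (lex-≡ _)   = lex-< x<y
lex-trans (lex-≡ _)   (lex-< y<z) = lex-< y<z
lex-trans (lex-≡ X≤Y) (lex-≡ Y≤Z) = lex-≡ (lex-trans X≤Y Y≤Z)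

lex? : ∀ {d} (X Y : Vec ℕ d) → Dec (X ≤lex Y)
lex? []ᵛ       []ᵛ       = yes lex-[]
lex? (x ∷ᵛ X) (y ∷ᵛ Y) with <-cmp x y
... | tri< x<y _ _ = yes (lex-< x<y)
... | tri> _ _ y<x = no λ { (lex-< x<y) → <-asym x<y y<x ; (lex-≡ _) → <-irrefl refl y<x }
... | tri≈ _ refl _ with lex? X Y
...   | yes X≤Y = yes (lex-≡ X≤Y)
...   | no  X≰Y = no λ { (lex-< x<x) → <-irrefl refl x<x ; (lex-≡ X≤Y) → X≰Y X≤Y }

_<lex_ : ∀ {d} → Vec ℕ d → Vec ℕ d → Set
X <lex Y = X ≤lex Y × ¬ (Y ≤lex X)

lex-increase : ∀ {d} (X Y : Vec ℕ d) i → (∀ m → toℕ m < toℕ i → lookup Y m ≡ lookup X m) →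
  lookup X i < lookup Y i → X <lex Y
lex-increase (x ∷ᵛ X) (y ∷ᵛ Y) fzero _ x<y =
  lex-< x<y , λ { (lex-< y<x) → <-asym x<y y<x ; (lex-≡ _) → <-irrefl refl x<y }
lex-increase (x ∷ᵛ X) (y ∷ᵛ Y) (fsuc i) same Xi<Yi with same fzero (s≤s z≤n)
... | refl with lex-increase X Y i (λ m m<i → same (fsuc m) (s≤s m<i)) Xi<Yi
...   | X≤Y , Y≰X = lex-≡ X≤Y , λ { (lex-< x<x) → <-irrefl refl x<x ; (lex-≡ Y≤X) → Y≰X Y≤X }

Dominates : ∀ {d} → Vec ℕ d → Vec ℕ d → Set
Dominates T Y = Y ≤lex T × (Y ≢ T → wt T < wt Y)

dominates? : ∀ {d} (T Y : Vec ℕ d) → Dec (Dominates T Y)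
dominates? T Y with lex? Y T | ≡-dec _≟_ Y T | wt T <? wt Y
... | no  Y≰T | _        | _          = no (λ dom → Y≰T (proj₁ dom))
... | yes Y≤T | yes Y≡T  | _          = yes (Y≤T , λ Y≢T → ⊥-elim (Y≢T Y≡T))
... | yes Y≤T | no  _    | yes wtT<wtY = yes (Y≤T , λ _ → wtT<wtY)
... | yes Y≤T | no  Y≢T  | no  wtT≮wtY = no (λ dom → wtT≮wtY (proj₂ dom Y≢T))

dominates⇒wt≤ : ∀ {d} (T Y : Vec ℕ d) → Dominates T Y → wt T ≤ wt Y
dominates⇒wt≤ T Y (_ , heavier) with ≡-dec _≟_ Y T
... | yes refl = ≤-refl
... | no  Y≢T  = <⇒≤ (heavier Y≢T)

module Transfer {d} (X : Vec ℕ d) (i i' : Fin d) (i<i' : toℕ i < toℕ i') (a' b' D : ℕ)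
                (a'≡ : a' ≡ lookup X i + D) (b≡ : lookup X i' ≡ b' + D) where

  Y : Vec ℕ d
  Y = (X [ i ]≔ a') [ i' ]≔ b'

  i≢i' : i ≢ i'
  i≢i' i≡i' = <-irrefl (cong toℕ i≡i') i<i'

  Y-at-i' : lookup Y i' ≡ b'
  Y-at-i' = lookup∘update i' (X [ i ]≔ a') b'

  Y-at-i : lookup Y i ≡ a'
  Y-at-i = trans (lookup∘update′ i≢i' (X [ i ]≔ a') b') (lookup∘update i X a')

  Y-elsewhere : ∀ m → m ≢ i → m ≢ i' → lookup Y m ≡ lookup X m
  Y-elsewhere m m≢i m≢i' = trans (lookup∘update′ m≢i' (X [ i ]≔ a') b') (lookup∘update′ m≢i X a')

  entrywise : (Q : Fin d → ℕ → Set) → Q i a' → Q i' b' → (∀ m → Q m (lookup X m)) → ∀ m → Q m (lookup Y m)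
  entrywise Q qa qb qX m with m ≟ᶠ i'
  ... | yes refl = subst (Q m) (sym Y-at-i') qb
  ... | no m≢i' with m ≟ᶠ i
  ...   | yes refl = subst (Q m) (sym Y-at-i) qa
  ...   | no  m≢i  = subst (Q m) (sym (Y-elsewhere m m≢i m≢i')) (qX m)

  ∑ᵛ-preserved : ∀ G → G a' + G b' ≡ G (lookup X i) + G (lookup X i') → ∑ᵛ G Y ≡ ∑ᵛ G X
  ∑ᵛ-preserved G balanced = +-cancelʳ-≡ (G b + G a) _ _ (begin
    ∑ᵛ G Y + (G b + G a)         ≡⟨ +-assoc (∑ᵛ G Y) (G b) (G a) ⟨
    ∑ᵛ G Y + G b + G a           ≡⟨ cong (λ z → ∑ᵛ G Y + G z + G a) (lookup∘update′ (i≢i' ∘ sym) X a') ⟨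
    ∑ᵛ G Y + G (lookup X₁ i') + G a
                                 ≡⟨ cong (_+ G a) (∑ᵛ-update G X₁ i' b') ⟩
    ∑ᵛ G X₁ + G b' + G a         ≡⟨ xy∙z≈xz∙y (∑ᵛ G X₁) (G b') (G a) ⟩
    ∑ᵛ G X₁ + G a + G b'         ≡⟨ cong (_+ G b') (∑ᵛ-update G X i a') ⟩
    ∑ᵛ G X + G a' + G b'         ≡⟨ +-assoc (∑ᵛ G X) (G a') (G b') ⟩
    ∑ᵛ G X + (G a' + G b')       ≡⟨ cong (∑ᵛ G X +_) (trans balanced (+-comm (G a) (G b))) ⟩
    ∑ᵛ G X + (G b + G a)         ∎)
    where
    open ≡-Reasoning
    a = lookup X i
    b = lookup X i'
    X₁ = X [ i ]≔ a'

  -- The weight drops by (i' - i)·D.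
  wt-decreases : 0 < D → wt Y < wt X
  wt-decreases 0<D = +-cancelʳ-< (c' * D) (wt Y) (wt X)
    (subst (_< wt X + c' * D) (sym (trans lower-step raise-step))
           (+-monoʳ-< (wt X) (*-monoˡ-< D {{>-nonZero 0<D}} (s≤s i<i'))))
    where
    c = 1 + toℕ i
    c' = 1 + toℕ i'
    raise-step : wt (X [ i ]≔ a') ≡ wt X + c * D
    raise-step = +-cancelʳ-≡ (c * lookup X i) _ _ (begin
      wt (X [ i ]≔ a') + c * lookup X i     ≡⟨ wtFrom-update 1 X i a' ⟩
      wt X + c * a'                         ≡⟨ cong (λ z → wt X + c * z) a'≡ ⟩
      wt X + c * (lookup X i + D)           ≡⟨ cong (wt X +_) (*-distribˡ-+ c (lookup X i) D) ⟩
      wt X + (c * lookup X i + c * D)       ≡⟨ x∙yz≈xz∙y (wt X) _ _ ⟩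
      wt X + c * D + c * lookup X i         ∎)
      where open ≡-Reasoning
    lower-step : wt Y + c' * D ≡ wt (X [ i ]≔ a')
    lower-step = +-cancelʳ-≡ (c' * b') _ _ (begin
      wt Y + c' * D + c' * b'               ≡⟨ x∙yz≈xz∙y (wt Y) _ _ ⟨
      wt Y + (c' * b' + c' * D)             ≡⟨ cong (wt Y +_) (*-distribˡ-+ c' b' D) ⟨
      wt Y + c' * (b' + D)                  ≡⟨ cong (λ z → wt Y + c' * z) (trans (sym b≡) (sym (lookup∘update′ (λ e → i≢i' (sym e)) X a'))) ⟩
      wt Y + c' * lookup (X [ i ]≔ a') i'   ≡⟨ wtFrom-update 1 (X [ i ]≔ a') i' b' ⟩
      wt (X [ i ]≔ a') + c' * b'            ∎)
      where open ≡-Reasoning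

  lex-increases : 0 < D → X <lex Y
  lex-increases 0<D = lex-increase X Y i
    (λ m m<i → Y-elsewhere m (λ e → <-irrefl (cong toℕ e) m<i) (λ e → <-irrefl (cong toℕ e) (<-trans m<i i<i')))
    (subst (lookup X i <_) (sym (trans Y-at-i a'≡)) (m<m+n (lookup X i) 0<D))

module Digits (r : ℕ) where

  p : ℕ
  p = suc (suc r)

  1<p : 1 < p
  1<p = s≤s (s≤s z≤n)

  digit<p : ∀ j n → digit p j n < p
  digit<p zero    n = m%n<n n p
  digit<p (suc j) n = digit<p j (n / p)

  n<p^n : ∀ n → n < p ^ n
  n<p^n zero    = s≤s z≤n
  n<p^n (suc n) = begin-strict
    suc n          ≤⟨ n<p^n n ⟩
    p ^ n          <⟨ m<m+n (p ^ n) (m^n>0 p n) ⟩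
    p ^ n + p ^ n  ≡⟨ cong (p ^ n +_) (+-identityʳ (p ^ n)) ⟨
    2 * p ^ n      ≤⟨ *-monoˡ-≤ (p ^ n) {2} {p} (s≤s (s≤s z≤n)) ⟩
    p * p ^ n      ∎
    where open ≤-Reasoning

  digit-small : ∀ j n → n < p ^ j → digit p j n ≡ 0
  digit-small zero    zero    _         = refl
  digit-small zero    (suc n) (s≤s ())
  digit-small (suc j) n n<p^j =
    digit-small j (n / p) (m<n*o⇒m/o<n (subst (n <_) (*-comm p (p ^ j)) n<p^j))

  digit-beyond : ∀ j n → n < j → digit p j n ≡ 0
  digit-beyond j n n<j = digit-small j n (<-≤-trans (n<p^n n) (^-monoʳ-≤ p (<⇒≤ n<j)))

  digit-of-0 : ∀ j → digit p j 0 ≡ 0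
  digit-of-0 j = digit-small j 0 (m^n>0 p j)

  %-unique : ∀ x y → x < p → (x + y * p) % p ≡ x
  %-unique x y x<p = trans ([m+kn]%n≡m%n x y p) (m<n⇒m%n≡m x<p)

  /-unique : ∀ x y → x < p → (x + y * p) / p ≡ y
  /-unique x y x<p = begin
    (x + y * p) / p      ≡⟨ +-distrib-/ x (y * p) no-carry ⟩
    x / p + y * p / p    ≡⟨ cong₂ _+_ (m<n⇒m/n≡0 x<p) (m*n/n≡m y p) ⟩
    y                    ∎
    where
    open ≡-Reasoning
    no-carry : x % p + (y * p) % p < p
    no-carry = subst₂ (λ u v → u + v < p) (sym (m<n⇒m%n≡m x<p)) (sym (m*n%n≡0 y p))
                      (subst (_< p) (sym (+-identityʳ x)) x<p)

  digit-ext : ∀ a b → (∀ j → digit p j a ≡ digit p j b) → a ≡ b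
  digit-ext a b same = bounded (a + b) a b
    (<-≤-trans (n<p^n a) (^-monoʳ-≤ p (m≤m+n a b)))
    (<-≤-trans (n<p^n b) (^-monoʳ-≤ p (m≤n+m b a))) same
    where
    bounded : ∀ B a b → a < p ^ B → b < p ^ B → (∀ j → digit p j a ≡ digit p j b) → a ≡ b
    bounded zero    zero    zero    _         _         _    = refl
    bounded zero    zero    (suc b) _         (s≤s ())  _
    bounded zero    (suc a) b       (s≤s ())  _         _
    bounded (suc B) a       b       a<p^B+1   b<p^B+1   same = begin
      a                        ≡⟨ m≡m%n+[m/n]*n a p ⟩
      a % p + (a / p) * p      ≡⟨ cong₂ (λ u v → u + v * p) (same 0)
                                   (bounded B (a / p) (b / p) (shift a<p^B+1) (shift b<p^B+1) (same ∘ suc)) ⟩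
      b % p + (b / p) * p      ≡⟨ m≡m%n+[m/n]*n b p ⟨
      b                        ∎
      where
      open ≡-Reasoning
      shift : ∀ {n} → n < p ^ suc B → n / p < p ^ B
      shift {n} n< = m<n*o⇒m/o<n (subst (n <_) (*-comm p (p ^ B)) n<)

  NoCarry : ℕ → ℕ → Set
  NoCarry a b = ∀ j → digit p j a + digit p j b < p

  digit-+ : ∀ j a b → NoCarry a b → digit p j (a + b) ≡ digit p j a + digit p j b
  digit-+ zero    a b nc = trans (%-distribˡ-+ a b p) (m<n⇒m%n≡m (nc 0))
  digit-+ (suc j) a b nc =
    trans (cong (digit p j) (+-distrib-/ a b (nc 0))) (digit-+ j (a / p) (b / p) (nc ∘ suc))

  digit-sum : ∀ xs → (∀ j → sum (map (digit p j) xs) < p) → ∀ j → digit p j (sum xs) ≡ sum (map (digit p j) xs)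
  digit-sum []       _  j = digit-of-0 j
  digit-sum (x ∷ xs) nc j = trans (digit-+ j x (sum xs) nc-head) (cong (digit p j x +_) (digit-sum xs nc-tail j))
    where
    nc-tail : ∀ j → sum (map (digit p j) xs) < p
    nc-tail m = ≤-<-trans (m≤n+m _ (digit p m x)) (nc m)
    nc-head : NoCarry x (sum xs)
    nc-head m = subst (λ z → digit p m x + z < p) (sym (digit-sum xs nc-tail m)) (nc m)

  p^[1+j]%p : ∀ j → p ^ suc j % p ≡ 0
  p^[1+j]%p j = trans (cong (_% p) (*-comm p (p ^ j))) (m*n%n≡0 (p ^ j) p)

  p^[1+j]/p : ∀ j → p ^ suc j / p ≡ p ^ j
  p^[1+j]/p j = trans (cong (_/ p) (*-comm p (p ^ j))) (m*n/n≡m (p ^ j) p)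

  digit-p^j : ∀ j → digit p j (p ^ j) ≡ 1
  digit-p^j zero    = m<n⇒m%n≡m 1<p
  digit-p^j (suc j) = trans (cong (digit p j) (p^[1+j]/p j)) (digit-p^j j)

  digit-p^j' : ∀ m j → m ≢ j → digit p m (p ^ j) ≡ 0
  digit-p^j' zero    zero    m≢j = ⊥-elim (m≢j refl)
  digit-p^j' zero    (suc j) _   = p^[1+j]%p j
  digit-p^j' (suc m) zero    _   = trans (cong (digit p m) (m<n⇒m/n≡0 1<p)) (digit-of-0 m)
  digit-p^j' (suc m) (suc j) m≢j =
    trans (cong (digit p m) (p^[1+j]/p j)) (digit-p^j' m j (m≢j ∘ cong suc))

  PowerSplit : ℕ → ℕ → Set
  PowerSplit j n = Σ ℕ λ Z → (n ≡ Z + p ^ j) × (∀ m → digit p m Z + digit p m (p ^ j) ≡ digit p m n)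

  split-power : ∀ j n → 0 < digit p j n → PowerSplit j n
  split-power zero n 0<n%p = Z , n≡Z+1 , digits
    where
    Z = (n % p ∸ 1) + (n / p) * p
    n%p-1<p : n % p ∸ 1 < p
    n%p-1<p = ≤-<-trans (m∸n≤m (n % p) 1) (m%n<n n p)
    n≡Z+1 : n ≡ Z + p ^ 0
    n≡Z+1 = begin
      n                                    ≡⟨ m≡m%n+[m/n]*n n p ⟩
      n % p + (n / p) * p                  ≡⟨ cong (_+ (n / p) * p) (m∸n+n≡m 0<n%p) ⟨
      (n % p ∸ 1 + 1) + (n / p) * p        ≡⟨ xy∙z≈xz∙y (n % p ∸ 1) 1 _ ⟩
      Z + 1                                ∎
      where open ≡-Reasoning
    digits : ∀ m → digit p m Z + digit p m (p ^ 0) ≡ digit p m n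
    digits zero    = trans (cong₂ _+_ (%-unique _ (n / p) n%p-1<p) (m<n⇒m%n≡m 1<p)) (m∸n+n≡m 0<n%p)
    digits (suc m) = trans (cong₂ _+_ (cong (digit p m) (/-unique _ (n / p) n%p-1<p))
                                      (trans (cong (digit p m) (m<n⇒m/n≡0 1<p)) (digit-of-0 m)))
                           (+-identityʳ _)
  split-power (suc j) n 0<digit with split-power j (n / p) 0<digit
  ... | Z' , n/p≡ , digits' = Z , n≡ , digits
    where
    Z = n % p + Z' * p
    n≡ : n ≡ Z + p ^ suc j
    n≡ = begin
      n                                    ≡⟨ m≡m%n+[m/n]*n n p ⟩
      n % p + (n / p) * p                  ≡⟨ cong (λ u → n % p + u * p) n/p≡ ⟩
      n % p + (Z' + p ^ j) * p             ≡⟨ cong (n % p +_) (*-distribʳ-+ p Z' (p ^ j)) ⟩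
      n % p + (Z' * p + p ^ j * p)         ≡⟨ +-assoc (n % p) _ _ ⟨
      Z + p ^ j * p                        ≡⟨ cong (Z +_) (*-comm (p ^ j) p) ⟩
      Z + p ^ suc j                        ∎
      where open ≡-Reasoning
    digits : ∀ m → digit p m Z + digit p m (p ^ suc j) ≡ digit p m n
    digits zero    = trans (cong₂ _+_ (%-unique _ Z' (m%n<n n p)) (p^[1+j]%p j)) (+-identityʳ _)
    digits (suc m) = trans (cong₂ _+_ (cong (digit p m) (/-unique _ Z' (m%n<n n p)))
                                      (cong (digit p m) (p^[1+j]/p j)))
                           (digits' m)

module Classes (r g : ℕ) where
  open Digits r public

  f : ℕ
  f = suc g

  inClass : ℕ → ℕ → Bool
  inClass k j = ⌊ j % f ≟ k ⌋

  p^-injective : ∀ a b → p ^ a ≡ p ^ b → a ≡ b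
  p^-injective a b e with <-cmp a b
  ... | tri< a<b _ _ = ⊥-elim (<-irrefl e (^-monoʳ-< p 1<p a<b))
  ... | tri≈ _ a≡b _ = a≡b
  ... | tri> _ _ b<a = ⊥-elim (<-irrefl (sym e) (^-monoʳ-< p 1<p b<a))

  μTerm : ℕ → ℕ → ℕ → ℕ
  μTerm k n j = if inClass k j then digit p j n else 0

  μ-as-∑< : ∀ k n M → suc n ≤ M → mu p f k n ≡ ∑< M (μTerm k n)
  μ-as-∑< k n M n<M = trans (sum-upTo (suc n) (μTerm k n))
    (sym (∑<-extend (suc n) M (μTerm k n) n<M (λ j n<j → if-0 (inClass k j) (digit-beyond j n n<j))))

  μ-+ : ∀ k x y → NoCarry x y → mu p f k (x + y) ≡ mu p f k x + mu p f k y
  μ-+ k x y nc = begin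
    mu p f k (x + y)                   ≡⟨ μ-as-∑< k (x + y) M ≤-refl ⟩
    ∑< M (μTerm k (x + y))             ≡⟨ ∑<-cong M (λ j → trans (cong (λ z → if inClass k j then z else 0) (digit-+ j x y nc))
                                                              (if-+ (inClass k j) _ _)) ⟩
    ∑< M (λ j → μTerm k x j + μTerm k y j)
                                       ≡⟨ ∑<-+ M (μTerm k x) (μTerm k y) ⟩
    ∑< M (μTerm k x) + ∑< M (μTerm k y) ≡⟨ cong₂ _+_ (μ-as-∑< k x M (s≤s (m≤m+n x y))) (μ-as-∑< k y M (s≤s (m≤n+m y x))) ⟨
    mu p f k x + mu p f k y            ∎
    where
    open ≡-Reasoning
    M = suc (x + y)

  μ-p^c : ∀ k c → mu p f k (p ^ c) ≡ (if inClass k c then 1 else 0)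
  μ-p^c k c = trans (μ-as-∑< k (p ^ c) (suc (p ^ c)) ≤-refl)
    (trans (∑<-single (suc (p ^ c)) _ c (λ j j≢c → if-0 (inClass k j) (digit-p^j' j c j≢c))
                      (λ p^c<c → ⊥-elim (<-irrefl refl (<-≤-trans (n<p^n c) (≤-trans (n≤1+n _) p^c<c)))))
           (cong (λ z → if inClass k c then z else 0) (digit-p^j c)))

  μ-exchange-power : ∀ k Z c e → c % f ≡ e % f → NoCarry Z (p ^ c) → NoCarry Z (p ^ e) →
                     mu p f k (Z + p ^ c) ≡ mu p f k (Z + p ^ e)
  μ-exchange-power k Z c e c≡e ncc nce = begin
    mu p f k (Z + p ^ c)                ≡⟨ μ-+ k Z (p ^ c) ncc ⟩
    mu p f k Z + mu p f k (p ^ c)       ≡⟨ cong (mu p f k Z +_) (μ-p^c k c) ⟩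
    mu p f k Z + (if inClass k c then 1 else 0)
                                        ≡⟨ cong (λ z → mu p f k Z + (if ⌊ z ≟ k ⌋ then 1 else 0)) c≡e ⟩
    mu p f k Z + (if inClass k e then 1 else 0)
                                        ≡⟨ cong (mu p f k Z +_) (μ-p^c k e) ⟨
    mu p f k Z + mu p f k (p ^ e)       ≡⟨ μ-+ k Z (p ^ e) nce ⟨
    mu p f k (Z + p ^ e)                ∎
    where open ≡-Reasoning

  τPiece : ℕ → ℕ → ℕ → List ℕ
  τPiece k n j = if inClass k j then replicate (digit p j n) (p ^ j) else []

  τBelow : ℕ → ℕ → ℕ → List ℕ
  τBelow M k n = concat (map (τPiece k n) (downFrom M))

  tau-as-τBelow : ∀ k n M → suc n ≤ M → tau p f k n ≡ τBelow M k n
  tau-as-τBelow k n M n<M = trans (cong (λ l → concat (map (τPiece k n) l)) (reverse-upTo (suc n)))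
                                  (sym (trans (cong (λ K → τBelow K k n) (sym (m∸n+n≡m n<M))) (pad (M ∸ suc n))))
    where
    pad : ∀ e → τBelow (e + suc n) k n ≡ τBelow (suc n) k n
    pad zero    = refl
    pad (suc e) with inClass k (e + suc n)
    ... | false = pad e
    ... | true  = trans (cong (λ c → replicate c (p ^ (e + suc n)) ++ τBelow (e + suc n) k n)
                              (digit-beyond (e + suc n) n (m≤n+m (suc n) e)))
                        (pad e)

  τPiece-∈ : ∀ {k n j u} → u ∈ τPiece k n j → u ≡ p ^ j × j % f ≡ k × 0 < digit p j n
  τPiece-∈ {k} {n} {j} u∈ with j % f ≟ k | digit p j n
  ... | yes j∈k | suc c = replicate-∈ {suc c} u∈ , j∈k , s≤s z≤n
  ... | no  _   | _     with u∈
  ...   | ()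

  τBelow-∈ : ∀ M {k n u} → u ∈ τBelow M k n → Σ ℕ λ j → j < M × u ≡ p ^ j × j % f ≡ k × 0 < digit p j n
  τBelow-∈ (suc M) {k} {n} u∈ with ∈-++⁻ (τPiece k n M) u∈
  ... | inj₁ u∈piece = M , ≤-refl , τPiece-∈ {k} {n} {M} u∈piece
  ... | inj₂ u∈rest with τBelow-∈ M u∈rest
  ...   | j , j<M , facts = j , m<n⇒m<1+n j<M , facts

  τBelow-descending : ∀ M k n → Descending (τBelow M k n)
  τBelow-descending zero    k n = []
  τBelow-descending (suc M) k n = AllPairs.++⁺ piece-descending (τBelow-descending M k n)
    (All.tabulate λ u∈ → All.tabulate λ w∈ → piece≥rest u∈ w∈)
    where
    piece-descending : Descending (τPiece k n M)
    piece-descending with inClass k M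
    ... | true  = replicate-descending _ _
    ... | false = []
    piece≥rest : ∀ {u w} → u ∈ τPiece k n M → w ∈ τBelow M k n → w ≤ u
    piece≥rest u∈ w∈ with τPiece-∈ {k} {n} {M} u∈ | τBelow-∈ M w∈
    ... | refl , _ | j , j<M , refl , _ = ^-monoʳ-≤ p (<⇒≤ j<M)

  τBelow-additive : (F : List ℕ → ℕ) → F [] ≡ 0 → (∀ xs ys → F (xs ++ ys) ≡ F xs + F ys) →
                    ∀ M k n → F (τBelow M k n) ≡ ∑< M (λ j → F (τPiece k n j))
  τBelow-additive F F[] F++ zero    k n = F[]
  τBelow-additive F F[] F++ (suc M) k n =
    trans (F++ (τPiece k n M) _) (trans (cong (F (τPiece k n M) +_) (τBelow-additive F F[] F++ M k n)) (+-comm (F (τPiece k n M)) _))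

  tau-descending : ∀ k n → Descending (tau p f k n)
  tau-descending k n = subst Descending (sym (tau-as-τBelow k n (suc n) ≤-refl)) (τBelow-descending (suc n) k n)

  tau-∈ : ∀ {k n u} → u ∈ tau p f k n → Σ ℕ λ j → u ≡ p ^ j × j % f ≡ k × 0 < digit p j n
  tau-∈ {k} {n} {u} u∈ with τBelow-∈ (suc n) (subst (u ∈_) (tau-as-τBelow k n (suc n) ≤-refl) u∈)
  ... | j , _ , facts = j , facts

  tau-length : ∀ k n → length (tau p f k n) ≡ mu p f k n
  tau-length k n = begin
    length (tau p f k n)                         ≡⟨ cong length (tau-as-τBelow k n (suc n) ≤-refl) ⟩
    length (τBelow (suc n) k n)                  ≡⟨ τBelow-additive length refl (λ xs ys → length-++ xs) (suc n) k n ⟩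
    ∑< (suc n) (λ j → length (τPiece k n j))     ≡⟨ ∑<-cong (suc n) piece-length ⟩
    ∑< (suc n) (μTerm k n)                       ≡⟨ μ-as-∑< k n (suc n) ≤-refl ⟨
    mu p f k n                                   ∎
    where
    open ≡-Reasoning
    piece-length : ∀ j → length (τPiece k n j) ≡ μTerm k n j
    piece-length j with inClass k j
    ... | true  = length-replicate _
    ... | false = refl

  occTerm : ℕ → ℕ → ℕ → ℕ → ℕ
  occTerm v k n j = if inClass k j then (if ⌊ v ≟ p ^ j ⌋ then digit p j n else 0) else 0

  tau-occ : ∀ v k n M → suc n ≤ M → occ v (tau p f k n) ≡ ∑< M (occTerm v k n)
  tau-occ v k n M n<M = trans (cong (occ v) (tau-as-τBelow k n M n<M))
    (trans (τBelow-additive (occ v) refl (occ-++ v) M k n) (∑<-cong M piece-occ))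
    where
    piece-occ : ∀ j → occ v (τPiece k n j) ≡ occTerm v k n j
    piece-occ j with inClass k j
    ... | true  = occ-replicate v _ _
    ... | false = refl

  digit-from-tau : ∀ j n → digit p j n ≡ occ (p ^ j) (tau p f (j % f) n)
  digit-from-tau j n = sym (trans (tau-occ (p ^ j) (j % f) n (suc n) ≤-refl)
                                  (trans (∑<-single (suc n) _ j other-terms (λ n<j → trans at-j (digit-beyond j n n<j))) at-j))
    where
    at-j : occTerm (p ^ j) (j % f) n j ≡ digit p j n
    at-j with j % f ≟ j % f
    ... | no  ≢ = ⊥-elim (≢ refl)
    ... | yes _ with p ^ j ≟ p ^ j
    ...   | no  ≢ = ⊥-elim (≢ refl)
    ...   | yes _ = refl
    other-terms : ∀ m → m ≢ j → occTerm (p ^ j) (j % f) n m ≡ 0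
    other-terms m m≢j with inClass (j % f) m
    ... | false = refl
    ... | true with p ^ j ≟ p ^ m
    ...   | yes e = ⊥-elim (m≢j (sym (p^-injective j m e)))
    ...   | no  _ = refl

module Compositions (r g : ℕ) where
  open Classes r g public

  q : ℕ
  q = p ^ f

  q^e≡1+c[q-1] : ∀ e → Σ ℕ λ c → q ^ e ≡ 1 + c * (q ∸ 1)
  q^e≡1+c[q-1] zero    = 0 , refl
  q^e≡1+c[q-1] (suc e) with q^e≡1+c[q-1] e
  ... | c , q^e≡ = c + q ^ e , (begin
    q * q ^ e                          ≡⟨ cong (_* q ^ e) (m∸n+n≡m (m^n>0 p f)) ⟨
    (q ∸ 1 + 1) * q ^ e                ≡⟨ cong (_* q ^ e) (+-comm (q ∸ 1) 1) ⟩
    q ^ e + (q ∸ 1) * q ^ e            ≡⟨ cong (_+ (q ∸ 1) * q ^ e) q^e≡ ⟩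
    1 + c * (q ∸ 1) + (q ∸ 1) * q ^ e  ≡⟨ +-assoc 1 (c * (q ∸ 1)) _ ⟩
    1 + (c * (q ∸ 1) + (q ∸ 1) * q ^ e) ≡⟨ cong (λ z → 1 + (c * (q ∸ 1) + z)) (*-comm (q ∸ 1) (q ^ e)) ⟩
    1 + (c * (q ∸ 1) + q ^ e * (q ∸ 1)) ≡⟨ cong (1 +_) (*-distribʳ-+ (q ∸ 1) c (q ^ e)) ⟨
    1 + (c + q ^ e) * (q ∸ 1)          ∎)
    where open ≡-Reasoning

  same-class⇒gap : ∀ j j' → j < j' → j % f ≡ j' % f → Σ ℕ λ e → 0 < e × j' ≡ j + e * f
  same-class⇒gap j j' j<j' same = e , 0<e , j'≡
    where
    open ≡-Reasoning
    e = j' / f ∸ j / f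
    gap : j' ∸ j ≡ e * f
    gap = begin
      j' ∸ j                                        ≡⟨ cong₂ _∸_ (m≡m%n+[m/n]*n j' f) (m≡m%n+[m/n]*n j f) ⟩
      (j' % f + j' / f * f) ∸ (j % f + j / f * f)   ≡⟨ cong (λ z → (z + j' / f * f) ∸ (j % f + j / f * f)) same ⟨
      (j % f + j' / f * f) ∸ (j % f + j / f * f)    ≡⟨ [m+n]∸[m+o]≡n∸o (j % f) _ _ ⟩
      j' / f * f ∸ j / f * f                        ≡⟨ *-distribʳ-∸ f (j' / f) (j / f) ⟨
      e * f                                         ∎
    j'≡ : j' ≡ j + e * f
    j'≡ = trans (sym (m+[n∸m]≡n (<⇒≤ j<j'))) (cong (j +_) gap)
    0<e : 0 < e
    0<e = *-cancelʳ-< f 0 e (subst (0 <_) gap (m<n⇒0<n∸m j<j'))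

  -- p^{j+ef} = p^j + D with D = p^j (q^e - 1) a positive multiple of q - 1.
  PowerGap : ℕ → ℕ → Set
  PowerGap j j' = Σ ℕ λ D → p ^ j' ≡ p ^ j + D × 0 < D × (q ∸ 1) ∣ D

  power-gap : ∀ j j' → j < j' → j % f ≡ j' % f → PowerGap j j'
  power-gap j j' j<j' same with same-class⇒gap j j' j<j' same
  ... | e , 0<e , refl with q^e≡1+c[q-1] e
  ...   | c , q^e≡ = p ^ j * (c * (q ∸ 1)) , p^j'≡ , 0<D , ∣n⇒∣m*n (p ^ j) (n∣m*n c)
    where
    p^j'≡ : p ^ (j + e * f) ≡ p ^ j + p ^ j * (c * (q ∸ 1))
    p^j'≡ = begin
      p ^ (j + e * f)                 ≡⟨ ^-distribˡ-+-* p j (e * f) ⟩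
      p ^ j * p ^ (e * f)             ≡⟨ cong (λ z → p ^ j * p ^ z) (*-comm e f) ⟩
      p ^ j * p ^ (f * e)             ≡⟨ cong (p ^ j *_) (^-*-assoc p f e) ⟨
      p ^ j * q ^ e                   ≡⟨ cong (p ^ j *_) q^e≡ ⟩
      p ^ j * (1 + c * (q ∸ 1))       ≡⟨ *-suc (p ^ j) (c * (q ∸ 1)) ⟩
      p ^ j + p ^ j * (c * (q ∸ 1))   ∎
      where open ≡-Reasoning
    0<c[q-1] : 0 < c * (q ∸ 1)
    0<c[q-1] = +-cancelˡ-< 1 0 _ (subst (1 <_) q^e≡ (^-monoʳ-< q (^-monoʳ-< p 1<p {0} {f} (s≤s z≤n)) 0<e))
    0<D : 0 < p ^ j * (c * (q ∸ 1))
    0<D = *-mono-≤ {1} {p ^ j} (m^n>0 p j) 0<c[q-1]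

  room-for-power : ∀ Z c e x → (∀ m → digit p m Z + digit p m (p ^ c) ≡ digit p m x) → c ≢ e →
                   suc (digit p e x) < p → NoCarry Z (p ^ e)
  room-for-power Z c e x split c≢e room m with m ≟ e
  ... | yes refl = subst₂ (λ u v → u + v < p) (sym digit-Z) (sym (digit-p^j m)) (subst (_< p) (+-comm 1 _) room)
    where
    digit-Z : digit p m Z ≡ digit p m x
    digit-Z = trans (sym (+-identityʳ _)) (trans (cong (digit p m Z +_) (sym (digit-p^j' m c (c≢e ∘ sym)))) (split m))
  ... | no m≢e = subst (_< p) (sym (trans (cong (digit p m Z +_) (digit-p^j' m e m≢e)) (+-identityʳ _)))
                       (≤-<-trans (subst (digit p m Z ≤_) (split m) (m≤m+n _ _)) (digit<p m x))

  Inversion : ℕ → ℕ → Set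
  Inversion a b = Σ ℕ λ j → Σ ℕ λ j' → j < j' × j % f ≡ j' % f × 0 < digit p j a × 0 < digit p j' b

  -- Exchanging the powers p^j of a and p^{j'} of b: a grows by D, b shrinks by D,
  -- while μ of both entries and the digit sums of the pair are unchanged.
  record Exchange (a b : ℕ) : Set where
    field
      a' b' D         : ℕ
      a'≡             : a' ≡ a + D
      b≡              : b ≡ b' + D
      0<D             : 0 < D
      q-1∣D           : (q ∸ 1) ∣ D
      0<b'            : 0 < b'
      μ-a'            : ∀ k → mu p f k a' ≡ mu p f k a
      μ-b'            : ∀ k → mu p f k b' ≡ mu p f k b
      digits-balanced : ∀ m → digit p m a' + digit p m b' ≡ digit p m a + digit p m b

  exchange : ∀ a b → NoCarry a b → Inversion a b → Exchange a b
  exchange a b nc (j , j' , j<j' , same , 0<aj , 0<bj') with split-power j a 0<aj | split-power j' b 0<bj'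
                                                          | power-gap j j' j<j' same
  ... | Z , a≡ , split-a | Z' , b≡ , split-b | D , p^j'≡ , 0<D , q-1∣D = record
    { a' = Z + p ^ j'
    ; b' = Z' + p ^ j
    ; D = D
    ; a'≡ = trans (cong (Z +_) p^j'≡) (trans (sym (+-assoc Z (p ^ j) D)) (cong (_+ D) (sym a≡)))
    ; b≡ = trans b≡ (trans (cong (Z' +_) p^j'≡) (sym (+-assoc Z' (p ^ j) D)))
    ; 0<D = 0<D
    ; q-1∣D = q-1∣D
    ; 0<b' = <-≤-trans (m^n>0 p j) (m≤n+m _ Z')
    ; μ-a' = λ k → trans (μ-exchange-power k Z j' j (sym same) nc-Z-j' nc-Z-j) (cong (mu p f k) (sym a≡))
    ; μ-b' = λ k → trans (μ-exchange-power k Z' j j' same nc-Z'-j nc-Z'-j') (cong (mu p f k) (sym b≡))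
    ; digits-balanced = balanced
    }
    where
    j≢j' : j ≢ j'
    j≢j' = <⇒≢ j<j'
    room : ∀ {x y} → 0 < y → x + y < p → suc x < p
    room {x} {y} 0<y x+y<p = ≤-<-trans (subst (_≤ x + y) (+-comm x 1) (+-monoʳ-≤ x 0<y)) x+y<p
    nc-Z-j : NoCarry Z (p ^ j)
    nc-Z-j m = subst (_< p) (sym (split-a m)) (digit<p m a)
    nc-Z'-j' : NoCarry Z' (p ^ j')
    nc-Z'-j' m = subst (_< p) (sym (split-b m)) (digit<p m b)
    nc-Z-j' : NoCarry Z (p ^ j')
    nc-Z-j' = room-for-power Z j j' a split-a j≢j' (room 0<bj' (nc j'))
    nc-Z'-j : NoCarry Z' (p ^ j)
    nc-Z'-j = room-for-power Z' j' j b split-b (j≢j' ∘ sym) (room 0<aj (subst (_< p) (+-comm (digit p j a) (digit p j b)) (nc j)))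
    balanced : ∀ m → digit p m (Z + p ^ j') + digit p m (Z' + p ^ j) ≡ digit p m a + digit p m b
    balanced m = begin
      digit p m (Z + p ^ j') + digit p m (Z' + p ^ j)
        ≡⟨ cong₂ _+_ (digit-+ m Z (p ^ j') nc-Z-j') (digit-+ m Z' (p ^ j) nc-Z'-j) ⟩
      (z + dj') + (z' + dj)    ≡⟨ cong ((z + dj') +_) (+-comm z' dj) ⟩
      (z + dj') + (dj + z')    ≡⟨ interchange z dj' dj z' ⟩
      (z + dj) + (dj' + z')    ≡⟨ cong ((z + dj) +_) (+-comm dj' z') ⟩
      (z + dj) + (z' + dj')    ≡⟨ cong₂ _+_ (split-a m) (split-b m) ⟩
      digit p m a + digit p m b ∎
      where
      open ≡-Reasoning
      z = digit p m Z
      z' = digit p m Z'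
      dj = digit p m (p ^ j)
      dj' = digit p m (p ^ j')

  InversionFree : ∀ {d} → Vec ℕ d → Set
  InversionFree {d} X = ∀ (i i' : Fin d) → toℕ i < toℕ i' → ¬ Inversion (lookup X i) (lookup X i')

  Above : ℕ → ℕ → ℕ → Set
  Above k a b = All (λ u → All (_≤ u) (tau p f k b)) (tau p f k a)

  no-inversion⇒above : ∀ k a b → ¬ Inversion a b → Above k a b
  no-inversion⇒above k a b no-inv = All.tabulate λ u∈ → All.tabulate λ w∈ → below u∈ w∈
    where
    below : ∀ {u w} → u ∈ tau p f k a → w ∈ tau p f k b → w ≤ u
    below u∈ w∈ with tau-∈ u∈ | tau-∈ w∈
    ... | j , refl , j∈k , 0<aj | j' , refl , j'∈k , 0<bj' with <-cmp j j'
    ...   | tri< j<j' _ _ = ⊥-elim (no-inv (j , j' , j<j' , trans j∈k (sym j'∈k) , 0<aj , 0<bj'))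
    ...   | tri≈ _ refl _ = ≤-refl
    ...   | tri> _ _ j'<j = ^-monoʳ-≤ p (<⇒≤ j'<j)

  occ-tau-sum : ∀ v k N xs → sum xs ≡ N → (∀ j → sum (map (digit p j) xs) < p) →
                occ v (tau p f k N) ≡ sum (map (λ x → occ v (tau p f k x)) xs)
  occ-tau-sum v k N xs sum≡N nc = sym (begin
    sum (map (λ x → occ v (tau p f k x)) xs)              ≡⟨ entries-below xs (≤-reflexive sum≡N) ⟩
    sum (map (λ x → ∑< M (occTerm v k x)) xs)             ≡⟨ sum-∑< M (occTerm v k) xs ⟩
    ∑< M (λ j → sum (map (λ x → occTerm v k x j) xs))     ≡⟨ ∑<-cong M occTerm-sum ⟩
    ∑< M (occTerm v k N)                                  ≡⟨ tau-occ v k N M ≤-refl ⟨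
    occ v (tau p f k N)                                   ∎)
    where
    open ≡-Reasoning
    M = suc N
    entries-below : ∀ ys → sum ys ≤ N →
      sum (map (λ x → occ v (tau p f k x)) ys) ≡ sum (map (λ x → ∑< M (occTerm v k x)) ys)
    entries-below []       _     = refl
    entries-below (y ∷ ys) ∑≤N = cong₂ _+_ (tau-occ v k y M (s≤s (≤-trans (m≤m+n y (sum ys)) ∑≤N)))
                                            (entries-below ys (≤-trans (m≤n+m (sum ys) y) ∑≤N))
    occTerm-sum : ∀ j → sum (map (λ x → occTerm v k x j) xs) ≡ occTerm v k N j
    occTerm-sum j with inClass k j
    ... | false = sum-if false (λ _ → 0) xs
    ... | true  = trans (sum-if ⌊ v ≟ p ^ j ⌋ (digit p j) xs)
                        (cong (λ z → if ⌊ v ≟ p ^ j ⌋ then z else 0)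
                              (trans (sym (digit-sum xs nc j)) (cong (digit p j) sum≡N)))

  -- An inversion-free composition is τ-monotonic: both sides of the defining equation
  -- are descending lists with the same multiplicities.
  inversionFree⇒τMonotonic : ∀ {d N} (X : Vec ℕ d) → InW p f d N X → InversionFree X → TauMonotonic p f d N X
  inversionFree⇒τMonotonic {d} {N} X (sum≡N , nc , _) free k = descending-unique _ _
    (tau-descending (toℕ k) N)
    (AllPairs.concat⁺ (All.map⁺ (All.tabulate λ {x} _ → tau-descending (toℕ k) x))
                      (AllPairs.map⁺ (allPairs-entries (Above (toℕ k)) X
                        (λ i i' i<i' → no-inversion⇒above (toℕ k) _ _ (free i i' i<i')))))
    (λ v → trans (occ-tau-sum v (toℕ k) N (toList X) sum≡N nc)
                 (sym (trans (occ-concat v (map (tau p f (toℕ k)) (toList X))) (cong sum (sym (map-∘ (toList X)))))))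

  -- A τ-monotonic composition is determined by its matrix Γ: the lengths μ_k of the
  -- blocks τ_k(X_i) cut τ_k(N) into the τ_k(X_i), which determine the digits of X_i.
  τMonotonic-unique : ∀ {d N} (X Y : Vec ℕ d) → TauMonotonic p f d N X → TauMonotonic p f d N Y →
    (∀ (k : Fin f) i → Gamma p f (lookup X i) k ≡ Gamma p f (lookup Y i) k) → X ≡ Y
  τMonotonic-unique X Y X-mono Y-mono sameΓ = vec-ext X Y λ i → digit-ext _ _ (same-digit i)
    where
    same-tau : ∀ (k : Fin f) i → tau p f (toℕ k) (lookup X i) ≡ tau p f (toℕ k) (lookup Y i)
    same-tau k = concat-split X Y (tau p f (toℕ k))
      (λ i → trans (tau-length (toℕ k) (lookup X i)) (trans (sameΓ k i) (sym (tau-length (toℕ k) (lookup Y i)))))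
      (trans (sym (X-mono k)) (Y-mono k))
    same-digit : ∀ i j → digit p j (lookup X i) ≡ digit p j (lookup Y i)
    same-digit i j = begin
      digit p j (lookup X i)                              ≡⟨ digit-from-tau j (lookup X i) ⟩
      occ (p ^ j) (tau p f (j % f) (lookup X i))          ≡⟨ cong (λ c → occ (p ^ j) (tau p f c (lookup X i))) class ⟨
      occ (p ^ j) (tau p f (toℕ k) (lookup X i))          ≡⟨ cong (occ (p ^ j)) (same-tau k i) ⟩
      occ (p ^ j) (tau p f (toℕ k) (lookup Y i))          ≡⟨ cong (λ c → occ (p ^ j) (tau p f c (lookup Y i))) class ⟩
      occ (p ^ j) (tau p f (j % f) (lookup Y i))          ≡⟨ digit-from-tau j (lookup Y i) ⟨
      digit p j (lookup Y i)                              ∎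
      where
      open ≡-Reasoning
      k : Fin f
      k = fromℕ< (m%n<n j f)
      class : toℕ k ≡ j % f
      class = toℕ-fromℕ< (m%n<n j f)

  SameΓ : ∀ {d} → Vec ℕ d → Vec ℕ d → Set
  SameΓ {d} X Y = ∀ (k : Fin f) (i : Fin d) → Gamma p f (lookup X i) k ≡ Gamma p f (lookup Y i) k

  Improvement : ∀ d N → Vec ℕ d → Set
  Improvement d N X = Σ (Vec ℕ d) λ Y → InW p f d N Y × SameΓ Y X × wt Y < wt X × X <lex Y

  resolve-inversion : ∀ {d N} (X : Vec ℕ d) → InW p f d N X → ∀ i i' → toℕ i < toℕ i' →
                      Inversion (lookup X i) (lookup X i') → Improvement d N X
  resolve-inversion {d} {N} X (sum≡N , nc , even) i i' i<i' inv =
    Y , (sum-Y , nc-Y , even-Y) , sameΓ , wt-decreases 0<D , lex-increases 0<D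
    where
    open Exchange (exchange (lookup X i) (lookup X i')
                            (λ m → ≤-<-trans (two-entries≤∑ᵛ (digit p m) X i i' (λ e → <-irrefl (cong toℕ e) i<i')) (nc m))
                            inv)
    open Transfer X i i' i<i' a' b' D a'≡ b≡
    sum-Y : sum (toList Y) ≡ N
    sum-Y = trans (cong sum (sym (map-id (toList Y))))
      (trans (∑ᵛ-preserved (λ x → x) (begin
                a' + b'                   ≡⟨ cong (_+ b') a'≡ ⟩
                lookup X i + D + b'       ≡⟨ xy∙z≈xz∙y (lookup X i) D b' ⟩
                lookup X i + b' + D       ≡⟨ +-assoc (lookup X i) b' D ⟩
                lookup X i + (b' + D)     ≡⟨ cong (lookup X i +_) b≡ ⟨
                lookup X i + lookup X i'  ∎))
             (trans (cong sum (map-id (toList X))) sum≡N))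
      where open ≡-Reasoning
    nc-Y : ∀ m → sum (map (digit p m) (toList Y)) < p
    nc-Y m = subst (_< p) (sym (∑ᵛ-preserved (digit p m) (digits-balanced m))) (nc m)
    even-Y : ∀ m → suc (toℕ m) < d → 0 < lookup Y m × (q ∸ 1) ∣ lookup Y m
    even-Y = entrywise (λ m v → suc (toℕ m) < d → 0 < v × (q ∸ 1) ∣ v)
      (λ _ → let (0<a , q-1∣a) = even i (≤-<-trans i<i' (toℕ<n i')) in
             subst (λ v → 0 < v × (q ∸ 1) ∣ v) (sym a'≡) (<-≤-trans 0<a (m≤m+n _ D) , ∣m∣n⇒∣m+n q-1∣a q-1∣D))
      (λ i'<d-1 → 0<b' , ∣m+n∣m⇒∣n (subst ((q ∸ 1) ∣_) (trans b≡ (+-comm b' D)) (proj₂ (even i' i'<d-1))) q-1∣D)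
      even
    sameΓ : SameΓ Y X
    sameΓ k = entrywise (λ m v → mu p f (toℕ k) v ≡ mu p f (toℕ k) (lookup X m))
      (μ-a' (toℕ k)) (μ-b' (toℕ k)) (λ _ → refl)

  HasInversion : ∀ {d} → Vec ℕ d → Set
  HasInversion {d} X = Σ (Fin d) λ i → Σ (Fin d) λ i' → toℕ i < toℕ i' × Inversion (lookup X i) (lookup X i')

  -- The τ-monotonic T ∈ W_d^B(N) dominates every Y ∈ W_d^B(N), by induction on wt Y:
  -- an inversion-free Y equals T, and otherwise resolving an inversion of Y gives a
  -- lighter, lexicographically larger Y' ∈ W_d^B(N).  The goal is decidable, so the
  -- (undecided) case distinction on inversions is justified by double negation.
  τMonotonic-dominates : ∀ {d N B} (T : Vec ℕ d) → InWB p f d N B T → TauMonotonic p f d N T →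
                         ∀ Y → InWB p f d N B Y → Dominates T Y
  τMonotonic-dominates {d} {N} {B} T (_ , ΓT) T-mono Y Y∈ = <-rec Goal step (wt Y) Y refl Y∈
    where
    Goal : ℕ → Set
    Goal w = ∀ Y → wt Y ≡ w → InWB p f d N B Y → Dominates T Y
    step : ∀ w → (∀ {w'} → w' < w → Goal w') → Goal w
    step _ rec Y refl (Y∈W , ΓY) = decidable-stable (dominates? T Y) (¬¬-map by-cases ¬¬-excluded-middle)
      where
      by-cases : Dec (HasInversion Y) → Dominates T Y
      by-cases (no none) with τMonotonic-unique {N = N} Y T
        (inversionFree⇒τMonotonic Y Y∈W (λ i i' i<i' inv → none (i , i' , i<i' , inv))) T-mono
        (λ k i → trans (ΓY k i) (sym (ΓT k i)))
      ... | refl = lex-refl Y , λ Y≢Y → ⊥-elim (Y≢Y refl)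
      by-cases (yes (i , i' , i<i' , inv)) with resolve-inversion Y Y∈W i i' i<i' inv
      ... | Y' , Y'∈W , ΓY'≡ΓY , wtY'<wtY , Y<Y' =
        lex-trans (proj₁ Y<Y') (proj₁ dom') , λ _ → ≤-<-trans (dominates⇒wt≤ T Y' dom') wtY'<wtY
        where
        dom' : Dominates T Y'
        dom' = rec wtY'<wtY Y' refl (Y'∈W , λ k m → trans (ΓY'≡ΓY k m) (ΓY k m))

  -- A modest composition has no inversion: resolving one would give a larger element of W_d(N).
  modest⇒τMonotonic : ∀ {d N} (X : Vec ℕ d) → Modest p f d N X → TauMonotonic p f d N X
  modest⇒τMonotonic X (X∈W , largest) = inversionFree⇒τMonotonic X X∈W λ i i' i<i' inv →
    let (Y , Y∈W , _ , _ , X<Y) = resolve-inversion X X∈W i i' i<i' inv in proj₂ X<Y (largest Y Y∈W)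

  -- An optimal composition has no inversion: resolving one would give a lighter element of W_d(N).
  optimal⇒τMonotonic : ∀ {d N} (X : Vec ℕ d) → Optimal p f d N X → TauMonotonic p f d N X
  optimal⇒τMonotonic X (X∈W , lightest) = inversionFree⇒τMonotonic X X∈W λ i i' i<i' inv →
    let (Y , Y∈W , _ , wtY<wtX , _) = resolve-inversion X X∈W i i' i<i' inv in <⇒≱ wtY<wtX (lightest Y Y∈W)

prime⇒2+r : ∀ p → Prime p → ∃ λ r → p ≡ suc (suc r)
prime⇒2+r 0             pr = ⊥-elim (<⇒≱ (nonTrivial⇒n>1 0 {{prime⇒nonTrivial pr}}) z≤n)
prime⇒2+r 1             pr = ⊥-elim (<-irrefl refl (nonTrivial⇒n>1 1 {{prime⇒nonTrivial pr}}))
prime⇒2+r (suc (suc r)) _  = r , refl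

lemma3p7 : (p f : ℕ) → Prime p → 1 ≤ f → (d : ℕ) → 1 ≤ d → (N : ℕ) → 1 ≤ N →
    ((B : Fin f → Fin d → ℕ) → Valid p f d N B →
      (T : Vec ℕ d) → InWB p f d N B T → TauMonotonic p f d N T →
        ((Y : Vec ℕ d) → InWB p f d N B Y → Y ≤lex T)
        × ((Y : Vec ℕ d) → InWB p f d N B Y → Y ≢ T → wt T < wt Y))
    × ((X : Vec ℕ d) → Modest p f d N X → TauMonotonic p f d N X)
    × ((X : Vec ℕ d) → Optimal p f d N X → TauMonotonic p f d N X)
lemma3p7 p (suc g) p-prime _ d _ N _ with prime⇒2+r p p-prime
... | r , refl =
  (λ B _ T T∈ T-mono → (λ Y Y∈ → proj₁ (τMonotonic-dominates {B = B} T T∈ T-mono Y Y∈))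
                     , (λ Y Y∈ → proj₂ (τMonotonic-dominates {B = B} T T∈ T-mono Y Y∈)))
  , modest⇒τMonotonic , optimal⇒τMonotonic
  where open Compositions r g using (τMonotonic-dominates; modest⇒τMonotonic; optimal⇒τMonotonic)
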